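{- If $G=(V,E)$ is a word-representable graph with representation number $k>3$, then $G$ is not $3$-complete square-free uniform word-representable.
   Context: For a word $w$ and a set $S$ of letters, $w_S$ is the word obtained from $w$ by deleting all letters not in $S$. Two distinct letters $x,y$ alternate in $w$ if $w_{\{x,y\}}$ is of the form $xyxy\cdots$ or $yxyx\cdots$ (even or odd length). A simple graph $G=(V,E)$ is word-representable if there is a word $w$ over $V$, containing every vertex, such that distinct $x,y$ alternate in $w$ iff $xy\in E$. A word is $k$-uniform (uniform) if every letter occurs exactly $k$ times; the representation number of a word-representable graph is the least $k$ such that some $k$-uniform word represents it. A square is a factor (block of consecutive letters) $XX$ with $X$ non-empty. A word $w$ contains a $p$-complete square if there is a set $S$ of letters such that $w_S$ contains a square $XX$ with $|X|\ge p$; otherwise $w$ is $p$-complete square-free. A graph $G$ is $p$-complete square-free uniform word-representable if it is represented by a uniform word $w$ that is $p$-complete square-free, where $1\le p\le\lceil|w|/2\rceil$. -}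

module Defs where

open import Data.Nat using (ℕ; _≤_; _<_; ⌈_/2⌉)
open import Data.Fin using (Fin; _≟_)
open import Data.Bool using (Bool; _∨_)
open import Data.List using (List; []; _∷_; _++_; length; filterᵇ)
open import Data.List.Membership.Propositional using (_∈_)
open import Data.Product using (Σ; _×_; ∃; ∃-syntax)
open import Relation.Nullary using (¬_; does)
open import Relation.Binary.PropositionalEquality using (_≡_; _≢_)
open import Function.Bundles using (_⇔_)

record Graph : Set₁ where
  field
    n      : ℕ
    Adj    : Fin n → Fin n → Set
    sym    : ∀ {x y} → Adj x y → Adj y x
    irrefl : ∀ {x} → ¬ Adj x x
open Graph public

Word : ℕ → Set
Word n = List (Fin n)

restrict : ∀ {n} → (Fin n → Bool) → Word n → Word n
restrict S w = filterᵇ S w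

pairSet : ∀ {n} → Fin n → Fin n → (Fin n → Bool)
pairSet x y a = does (a ≟ x) ∨ does (a ≟ y)

data NoStutter {n} : Word n → Set where
  ns-[]  : NoStutter []
  ns-[a] : ∀ a → NoStutter (a ∷ [])
  ns-∷   : ∀ {a b u} → a ≢ b → NoStutter (b ∷ u) → NoStutter (a ∷ b ∷ u)

-- x and y alternate in w: w_{x,y} is xyxy... or yxyx... ; since w_{x,y} only
-- contains letters x,y, this means exactly that no two consecutive letters are equal.
Alternate : ∀ {n} → Word n → Fin n → Fin n → Set
Alternate w x y = NoStutter (restrict (pairSet x y) w)

count : ∀ {n} → Fin n → Word n → ℕ
count v w = length (filterᵇ (λ a → does (a ≟ v)) w)

Uniform : ∀ {n} → ℕ → Word n → Set
Uniform {n} k w = (v : Fin n) → count v w ≡ k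

Represents : (G : Graph) → Word (n G) → Set
Represents G w =
  ((v : Fin (n G)) → v ∈ w) ×
  ((x y : Fin (n G)) → x ≢ y → (Alternate w x y ⇔ Adj G x y))

WordRepresentable : Graph → Set
WordRepresentable G = Σ (Word (n G)) (Represents G)

RepresentationNumber : Graph → ℕ → Set
RepresentationNumber G k =
  WordRepresentable G ×
  (∃[ w ] (Uniform k w × Represents G w)) ×
  (∀ k′ → k′ < k → ¬ (∃[ w ] (Uniform k′ w × Represents G w)))

ContainsCompleteSquare : ∀ {n} → ℕ → Word n → Set
ContainsCompleteSquare {n} p w =
  ∃[ S ] ∃[ u ] ∃[ X ] ∃[ v ]
    (p ≤ length X × restrict {n} S w ≡ u ++ X ++ X ++ v)

CompleteSquareFree : ∀ {n} → ℕ → Word n → Set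
CompleteSquareFree p w = ¬ ContainsCompleteSquare p w

CSFUniformWordRepresentable : ℕ → Graph → Set
CSFUniformWordRepresentable p G =
  ∃[ w ] ∃[ k ]
    (Uniform k w × Represents G w × CompleteSquareFree p w ×
     1 ≤ p × p ≤ ⌈ length w /2⌉)

-- If some vertices x, y of G were adjacent, then in a k-uniform representant
-- with k ≥ 4 the restriction to {x, y} would be an alternating word of length
-- 2k ≥ 8, hence start with (abab)(abab): a complete square with |X| = 4.  So a
-- 3-complete square-free uniform representant forces G to be edgeless.  But
-- every edgeless graph is represented by the 2-uniform word 1122⋯nn, so its
-- representation number is at most 2.
module Submission where

open import Defs
open import Data.Nat using (ℕ; _<_; suc; _+_; _≤_; s≤s)
open import Data.Nat.Properties using (≮⇒≥; ≤-refl; ≤-trans; n≤1+n; +-mono-≤; +-suc)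
open import Data.Fin using (Fin; _≟_) renaming (zero to fzero; suc to fsuc)
open import Data.Bool using (T; T?)
open import Data.List using (List; []; _∷_; _++_; length; map; filter; allFin)
open import Data.List.Properties using (map-tabulate; filter-accept; filter-reject)
open import Data.List.Membership.Propositional using (_∈_)
open import Data.List.Membership.Propositional.Properties using (∈-allFin; ∈-filter⁺)
open import Data.List.Relation.Unary.All using (All; []; _∷_)
open import Data.List.Relation.Unary.Any using (here; there)
open import Data.Product using (∃-syntax; _×_; _,_)
open import Data.Sum using (_⊎_; inj₁; inj₂)
open import Data.Empty using (⊥-elim)
open import Relation.Nullary using (¬_; Dec; yes; no; does)
open import Relation.Unary using (Pred; Decidable)
open import Relation.Binary.PropositionalEquality
  using (_≡_; _≢_; refl; trans; cong; subst; subst₂; module ≡-Reasoning)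
  renaming (sym to ≡-sym)
open import Function.Base using (_∘_)
open import Function.Bundles using (mk⇔; Equivalence)

private
  variable
    m : ℕ

≤-containsCompleteSquare : ∀ {p q} {w : Word m} →
  p ≤ q → ContainsCompleteSquare q w → ContainsCompleteSquare p w
≤-containsCompleteSquare p≤q (S , u , X , v , q≤|X| , w↾S≡uXXv) =
  S , u , X , v , ≤-trans p≤q q≤|X| , w↾S≡uXXv

OneOf : Fin m → Fin m → Fin m → Set
OneOf x y a = a ≡ x ⊎ a ≡ y

restrict-pairSet-oneOf : (x y : Fin m) (w : Word m) →
  All (OneOf x y) (restrict (pairSet x y) w)
restrict-pairSet-oneOf x y [] = []
restrict-pairSet-oneOf x y (a ∷ w) with a ≟ x | a ≟ y
... | yes a≡x | _       = inj₁ a≡x ∷ restrict-pairSet-oneOf x y w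
... | no _    | yes a≡y = inj₂ a≡y ∷ restrict-pairSet-oneOf x y w
... | no _    | no _    = restrict-pairSet-oneOf x y w

length-restrict-pairSet : {x y : Fin m} → x ≢ y → (w : Word m) →
  length (restrict (pairSet x y) w) ≡ count x w + count y w
length-restrict-pairSet x≢y [] = refl
length-restrict-pairSet {x = x} {y} x≢y (a ∷ w) with a ≟ x | a ≟ y
... | yes refl | yes refl = ⊥-elim (x≢y refl)
... | yes _    | no _     = cong suc (length-restrict-pairSet x≢y w)
... | no _     | yes _    = trans (cong suc (length-restrict-pairSet x≢y w))
                                  (≡-sym (+-suc (count x w) (count y w)))
... | no _     | no _     = length-restrict-pairSet x≢y w

oneOf-≢-≢⇒≡ : {x y p q r : Fin m} → OneOf x y p → OneOf x y q → OneOf x y r →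
  p ≢ q → q ≢ r → p ≡ r
oneOf-≢-≢⇒≡ (inj₁ refl) (inj₁ refl) _           p≢q _   = ⊥-elim (p≢q refl)
oneOf-≢-≢⇒≡ (inj₂ refl) (inj₂ refl) _           p≢q _   = ⊥-elim (p≢q refl)
oneOf-≢-≢⇒≡ _           (inj₁ refl) (inj₁ refl) _   q≢r = ⊥-elim (q≢r refl)
oneOf-≢-≢⇒≡ _           (inj₂ refl) (inj₂ refl) _   q≢r = ⊥-elim (q≢r refl)
oneOf-≢-≢⇒≡ (inj₁ refl) (inj₂ refl) (inj₁ refl) _   _   = refl
oneOf-≢-≢⇒≡ (inj₂ refl) (inj₁ refl) (inj₂ refl) _   _   = refl

alternating⇒square : {x y : Fin m} (u : Word m) → All (OneOf x y) u →
  NoStutter u → 8 ≤ length u →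
  ∃[ a ] ∃[ b ] ∃[ v ] u ≡ (a ∷ b ∷ a ∷ b ∷ []) ++ (a ∷ b ∷ a ∷ b ∷ []) ++ v
alternating⇒square (a ∷ b ∷ c ∷ d ∷ e ∷ f ∷ g ∷ h ∷ v)
  (oa ∷ ob ∷ oc ∷ od ∷ oe ∷ of ∷ og ∷ oh ∷ _)
  (ns-∷ a≢b (ns-∷ b≢c (ns-∷ c≢d (ns-∷ d≢e (ns-∷ e≢f (ns-∷ f≢g (ns-∷ g≢h _)))))))
  (s≤s (s≤s (s≤s (s≤s (s≤s (s≤s (s≤s (s≤s _))))))))
  with oneOf-≢-≢⇒≡ oa ob oc a≢b b≢c | oneOf-≢-≢⇒≡ ob oc od b≢c c≢d
     | oneOf-≢-≢⇒≡ oc od oe c≢d d≢e | oneOf-≢-≢⇒≡ od oe of d≢e e≢f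
     | oneOf-≢-≢⇒≡ oe of og e≢f f≢g | oneOf-≢-≢⇒≡ of og oh f≢g g≢h
... | refl | refl | refl | refl | refl | refl = a , b , v , refl

adjacent⇒containsCompleteSquare : (G : Graph) {k : ℕ} {w : Word (n G)} →
  Represents G w → Uniform k w → 4 ≤ k →
  {x y : Fin (n G)} → Adj G x y → ContainsCompleteSquare 4 w
adjacent⇒containsCompleteSquare G {w = w} (_ , alternate⇔adj) uniform 4≤k {x} {y} adj
  with alternating⇒square (restrict (pairSet x y) w) (restrict-pairSet-oneOf x y w)
         (Equivalence.from (alternate⇔adj x y x≢y) adj) 8≤length
  where
  x≢y : x ≢ y
  x≢y refl = irrefl G adj
  8≤length : 8 ≤ length (restrict (pairSet x y) w)
  8≤length = subst (8 ≤_) (≡-sym (length-restrict-pairSet x≢y w))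
    (subst₂ (λ i j → 8 ≤ i + j) (≡-sym (uniform x)) (≡-sym (uniform y))
      (+-mono-≤ 4≤k 4≤k))
... | a , b , v , w↾xy≡abababab =
  pairSet x y , [] , a ∷ b ∷ a ∷ b ∷ [] , v , ≤-refl , w↾xy≡abababab

doubled : ∀ {ℓ} {A : Set ℓ} → List A → List A
doubled []      = []
doubled (a ∷ l) = a ∷ a ∷ doubled l

length-doubled : ∀ {ℓ} {A : Set ℓ} (l : List A) → length (doubled l) ≡ length l + length l
length-doubled []      = refl
length-doubled (a ∷ l) = cong suc (trans (cong suc (length-doubled l))
                                         (≡-sym (+-suc (length l) (length l))))

filter-doubled : ∀ {ℓ p} {A : Set ℓ} {P : Pred A p} (P? : Decidable P) (l : List A) →
  filter P? (doubled l) ≡ doubled (filter P? l)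
filter-doubled P? []      = refl
filter-doubled {P = P} P? (a ∷ l) = by-cases (P? a)
  where
  open ≡-Reasoning
  by-cases : Dec (P a) → filter P? (doubled (a ∷ l)) ≡ doubled (filter P? (a ∷ l))
  by-cases (yes Pa) = begin
    filter P? (a ∷ a ∷ doubled l)     ≡⟨ filter-accept P? Pa ⟩
    a ∷ filter P? (a ∷ doubled l)     ≡⟨ cong (a ∷_) (filter-accept P? Pa) ⟩
    a ∷ a ∷ filter P? (doubled l)     ≡⟨ cong (λ r → a ∷ a ∷ r) (filter-doubled P? l) ⟩
    doubled (a ∷ filter P? l)         ≡⟨ cong doubled (filter-accept P? Pa) ⟨
    doubled (filter P? (a ∷ l))       ∎
  by-cases (no ¬Pa) = begin
    filter P? (a ∷ a ∷ doubled l)     ≡⟨ filter-reject P? ¬Pa ⟩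
    filter P? (a ∷ doubled l)         ≡⟨ filter-reject P? ¬Pa ⟩
    filter P? (doubled l)             ≡⟨ filter-doubled P? l ⟩
    doubled (filter P? l)             ≡⟨ cong doubled (filter-reject P? ¬Pa) ⟨
    doubled (filter P? (a ∷ l))       ∎

count-doubled : (v : Fin m) (l : Word m) → count v (doubled l) ≡ count v l + count v l
count-doubled v l = begin
  length (filter P? (doubled l))  ≡⟨ cong length (filter-doubled P? l) ⟩
  length (doubled (filter P? l))  ≡⟨ length-doubled (filter P? l) ⟩
  count v l + count v l           ∎
  where
  open ≡-Reasoning
  P? : Decidable (λ a → T (does (a ≟ v)))
  P? a = T? (does (a ≟ v))

∈-doubled : ∀ {ℓ} {A : Set ℓ} {v : A} {l : List A} → v ∈ l → v ∈ doubled l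
∈-doubled (here v≡a)  = here v≡a
∈-doubled (there v∈l) = there (there (∈-doubled v∈l))

doubled-stutters : {v : Fin m} {l : Word m} → v ∈ l → ¬ NoStutter (doubled l)
doubled-stutters {l = _ ∷ _} _ (ns-∷ a≢a _) = a≢a refl

count-fzero-map-fsuc : (l : Word m) → count fzero (map fsuc l) ≡ 0
count-fzero-map-fsuc []      = refl
count-fzero-map-fsuc (_ ∷ l) = count-fzero-map-fsuc l

count-fsuc-map-fsuc : (v : Fin m) (l : Word m) → count (fsuc v) (map fsuc l) ≡ count v l
count-fsuc-map-fsuc v []      = refl
count-fsuc-map-fsuc v (a ∷ l) with a ≟ v
... | yes refl = cong suc (count-fsuc-map-fsuc v l)
... | no _     = count-fsuc-map-fsuc v l

allFin-suc : allFin (suc m) ≡ fzero ∷ map fsuc (allFin m)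
allFin-suc {m} = cong (fzero ∷_) (≡-sym (map-tabulate (λ i → i) (fsuc {m})))

count-allFin : (v : Fin m) → count v (allFin m) ≡ 1
count-allFin {suc m} fzero = begin
  count fzero (allFin (suc m))           ≡⟨ cong (count fzero) (allFin-suc {m}) ⟩
  suc (count fzero (map fsuc (allFin m))) ≡⟨ cong suc (count-fzero-map-fsuc (allFin m)) ⟩
  1                                       ∎
  where open ≡-Reasoning
count-allFin {suc m} (fsuc v) = begin
  count (fsuc v) (allFin (suc m))        ≡⟨ cong (count (fsuc v)) (allFin-suc {m}) ⟩
  count (fsuc v) (map fsuc (allFin m))   ≡⟨ count-fsuc-map-fsuc v (allFin m) ⟩
  count v (allFin m)                     ≡⟨ count-allFin v ⟩
  1                                      ∎
  where open ≡-Reasoning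

pairSet-left : (x y : Fin m) → T (pairSet x y x)
pairSet-left x y with x ≟ x
... | yes _  = _
... | no x≢x = ⊥-elim (x≢x refl)

edgeless⇒2-uniformRepresentable : (G : Graph) → (∀ x y → ¬ Adj G x y) →
  ∃[ w ] (Uniform 2 w × Represents G w)
edgeless⇒2-uniformRepresentable G noEdge =
  w , uniform , (λ v → ∈-doubled (∈-allFin v)) , λ x y _ →
    mk⇔ (⊥-elim ∘ notAlternate x y) (⊥-elim ∘ noEdge x y)
  where
  w : Word (n G)
  w = doubled (allFin (n G))
  uniform : Uniform 2 w
  uniform v = trans (count-doubled v (allFin (n G))) (cong (λ c → c + c) (count-allFin v))
  notAlternate : ∀ x y → ¬ Alternate w x y
  notAlternate x y = doubled-stutters (∈-filter⁺ (T? ∘ pairSet x y) (∈-allFin x) (pairSet-left x y))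
                     ∘ subst NoStutter (filter-doubled (T? ∘ pairSet x y) (allFin (n G)))

mainTheorem15 : (G : Graph) (k : ℕ) → RepresentationNumber G k → 3 < k →
    ¬ CSFUniformWordRepresentable 3 G
mainTheorem15 G k (_ , _ , minimal) 3<k (w , k′ , uniform , represents , squareFree , _) =
  minimal 2 (≤-trans (n≤1+n 3) 3<k) (edgeless⇒2-uniformRepresentable G noEdge)
  where
  4≤k′ : 4 ≤ k′
  4≤k′ = ≤-trans 3<k (≮⇒≥ (λ k′<k → minimal k′ k′<k (w , uniform , represents)))
  noEdge : ∀ x y → ¬ Adj G x y
  noEdge x y adj = squareFree (≤-containsCompleteSquare {w = w} (n≤1+n 3)
    (adjacent⇒containsCompleteSquare G represents uniform 4≤k′ adj))
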